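{- For all $n,k\in\mathbb{N}$, $$S_B[n,k]=\sum_{\rho\in S_B(\langle n\rangle,k)} q^{\operatorname{inv}\rho}.$$
   Context: $[m]=(1-q^m)/(1-q)$; $S_B[n,k]$ is defined by $S_B[0,k]=\delta_{0,k}$ ($k\in\mathbb{Z}$) and $S_B[n,k]=S_B[n-1,k-1]+[2k+1]S_B[n-1,k]$ for $n\ge1$. Let $\langle n\rangle=\{ -n,\ldots,n\}$. A signed (type $B$) partition of $\langle n\rangle$ is a set partition of $\langle n\rangle$ into blocks $S_0,S_1,\ldots,S_{2k}$ such that $0\in S_0$, $S_0=-S_0$, and the other blocks come in pairs $\{B,-B\}$ with $B\ne -B$ (where $-B=\{ -b: b\in B\}$). $S_B(\langle n\rangle,k)$ is the set of such partitions with $2k+1$ blocks. Write such a partition in standard form: $S_0$ is the block containing $0$; for each pair $\{B,-B\}$ let $m=\min\{|b|:b\in B\}$, and label the pairs so that the pair with the $i$-th smallest such $m$ is $\{S_{2i-1},S_{2i}\}$ with $m\in S_{2i}$ and $S_{2i-1}=-S_{2i}$. Set $m_j=\min\{|s|:s\in S_j\}$, so $0=m_0<m_2<\cdots<m_{2k}$ and $m_{2i-1}=m_{2i}$. An inversion of $\rho$ is a pair $(s,S_j)$ such that $s\in S_i$ for some $i<j$ and $s\ge m_j$; $\operatorname{inv}\rho$ is the number of inversions. -}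

module Defs where

open import Level using (Level)
open import Data.Bool using (Bool; true; false; _∧_; if_then_else_)
open import Data.Nat using (ℕ; zero; suc; _+_; _*_; _∸_; _⊓_; _%_; _≡ᵇ_; _<ᵇ_)
open import Data.Integer using (ℤ; +_; _⊖_; ∣_∣; -_; _≤?_) renaming (_+_ to _+ℤ_)
open import Data.List using (List; []; _∷_; map; concatMap; upTo; filterᵇ; length; foldr; null)
open import Relation.Nullary.Decidable using (⌊_⌋)
open import Algebra.Bundles using (CommutativeSemiring)

elems : ℕ → List ℤ
elems n = map (λ p → p ⊖ n) (upTo (suc (2 * n)))

-- A signed partition of ⟨n⟩ in standard form is encoded by its block-label
-- function ⟨n⟩ → {0,…,2k}: a word w of length 2n+1 whose entry at position
-- x+n is the index j of the block S_j containing x.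
allB : {A : Set} → (A → Bool) → List A → Bool
allB p = foldr (λ x b → p x ∧ b) true

nth : List ℕ → ℕ → ℕ
nth []       _       = 0
nth (a ∷ _)  zero    = a
nth (_ ∷ as) (suc i) = nth as i

lab : ℕ → List ℕ → ℤ → ℕ
lab n w x = nth w ∣ x +ℤ + n ∣

words : ℕ → ℕ → List (List ℕ)
words zero    b = [] ∷ []
words (suc L) b = concatMap (λ w → map (_∷ w) (upTo b)) (words L b)

block : ℕ → List ℕ → ℕ → List ℤ
block n w j = filterᵇ (λ x → lab n w x ≡ᵇ j) (elems n)

minL : List ℕ → ℕ
minL []       = 0
minL (x ∷ xs) = foldr _⊓_ x xs

mval : ℕ → List ℕ → ℕ → ℕ
mval n w j = minL (map ∣_∣ (block n w j))

-- the index of the partner block: 0 ↦ 0, 2i-1 ↔ 2i (i ≥ 1)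
partner : ℕ → ℕ
partner zero    = 0
partner (suc j) = if (j % 2) ≡ᵇ 0 then suc (suc j) else j

-- w (a word of length 2n+1 over {0,…,2k}) is the standard-form labelling of a
-- signed partition of ⟨n⟩ with exactly 2k+1 blocks S_0,…,S_{2k}:
isStd : ℕ → ℕ → List ℕ → Bool
isStd n k w =
  (lab n w (+ 0) ≡ᵇ 0)
  ∧ allB (λ j → Data.Bool.not (null (block n w j))) (upTo (suc (2 * k)))
  ∧ allB (λ x → lab n w (- x) ≡ᵇ partner (lab n w x)) (elems n)
  ∧ allB (λ i → lab n w (+ mval n w (2 * suc i)) ≡ᵇ 2 * suc i) (upTo k)
  ∧ allB (λ i → mval n w (2 * suc i) <ᵇ mval n w (2 * suc (suc i))) (upTo (k ∸ 1))

SBset : ℕ → ℕ → List (List ℕ)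
SBset n k = filterᵇ (isStd n k) (words (suc (2 * n)) (suc (2 * k)))

inv : ℕ → ℕ → List ℕ → ℕ
inv n k w = foldr _+_ 0 (map (λ j →
   length (filterᵇ (λ s → (lab n w s <ᵇ j) ∧ ⌊ + mval n w j ≤? s ⌋) (elems n)))
   (upTo (suc (2 * k))))

-- Algebraic part: q is an element of an arbitrary commutative semiring
-- (equivalent to q being a formal variable over ℕ).

module _ {c ℓ : Level} (R : CommutativeSemiring c ℓ) (q : CommutativeSemiring.Carrier R) where
  open CommutativeSemiring R using (Carrier; 0#; 1#) renaming (_+_ to _⊕_; _*_ to _⊛_)

  pow : ℕ → Carrier
  pow zero    = 1#
  pow (suc m) = q ⊛ pow m

  qint : ℕ → Carrier
  qint zero    = 0#
  qint (suc m) = 1# ⊕ (q ⊛ qint m)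

  -- S_B[n,k] for k ≥ 0 (S_B[n,k] = 0 for k < 0, so S_B[n-1,-1] = 0)
  SB : ℕ → ℕ → Carrier
  SB zero    zero    = 1#
  SB zero    (suc k) = 0#
  SB (suc n) zero    = qint 1 ⊛ SB n zero
  SB (suc n) (suc k) = SB n k ⊕ (qint (2 * suc k + 1) ⊛ SB n (suc k))

  SBsum : ℕ → ℕ → Carrier
  SBsum n k = foldr (λ w acc → pow (inv n k w) ⊕ acc) 0# (SBset n k)

module Submission where

-- A word of length 2n+3 over {0,…,2k} is a labelling of ⟨n+1⟩: its first and last letters a and b
-- label -(n+1) and n+1, and the letters in between label ⟨n⟩.  If the inner labelling is standard
-- with 2k+1 blocks, then the whole word is standard exactly when a is the partner of b; the minima
-- m_j do not change, -(n+1) is never an inversion, and n+1 ∈ S_b is an inversion for exactly the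
-- 2k-b blocks S_j with j > b, so summing over b multiplies q^inv by [2k+1].  If the inner labelling
-- is not standard, the whole word can only be standard when {-(n+1)} and {n+1} are the last pair of
-- blocks S_{2k-1}, S_{2k}; then the inner labelling is standard with 2k-1 blocks and no inversions
-- are added.  Hence the weighted sums satisfy the recurrence defining S_B[n,k].

open import Defs
open import Algebra.Bundles using (CommutativeMonoid; CommutativeSemiring)
import Algebra.Properties.CommutativeSemigroup as CommutativeSemigroupProperties
open import Data.Bool using (Bool; true; false; T; _∧_; not; if_then_else_)
open import Data.Bool.Properties using (T-≡; T-∧; ∧-identityʳ; ∧-zeroʳ)
open import Data.Empty using (⊥-elim)
open import Data.Integer using (ℤ; +_; -[1+_]; _⊖_; ∣_∣; -_; _≤?_; +≤+)
import Data.Integer.Properties as ℤ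
open import Data.List
  using (List; []; _∷_; _++_; map; upTo; applyUpTo; filterᵇ; null; length; foldr; concatMap)
import Data.List.Properties as List
open import Data.List.Membership.Propositional using (_∈_; _∉_)
open import Data.List.Membership.Propositional.Properties
  using (∈-map⁺; ∈-map⁻; ∈-concat⁻′; ∈-++⁺ˡ; ∈-++⁺ʳ; ∈-++⁻; ∈-upTo⁺; ∈-upTo⁻;
         ∈-filter⁺; ∈-filter⁻; foldr-selective)
open import Data.List.Relation.Unary.All as All using (All; []; _∷_)
open import Data.List.Relation.Unary.Any using (here; there)
open import Data.Nat
  using (ℕ; zero; suc; _+_; _*_; _∸_; _⊓_; _≡ᵇ_; _<ᵇ_; _≤_; _<_; z≤n; s≤s; s≤s⁻¹)
open import Data.Nat.DivMod using (_%_; m*n%n≡0; [m+kn]%n≡m%n)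
open import Data.Nat.Properties hiding (_≤?_)
open import Data.Product using (∃; ∃-syntax; _×_; _,_; proj₁; proj₂)
open import Data.Sum using (_⊎_; inj₁; inj₂)
open import Data.Unit using (tt)
open import Function using (_∘_; case_of_; _⇔_; mk⇔; Equivalence)
open import Relation.Nullary using (¬_; yes; no; contradiction)
open import Relation.Nullary.Decidable using (T?; ⌊_⌋; fromWitness; toWitness)
import Relation.Binary.Reasoning.Setoid as SetoidReasoning
import Relation.Binary.PropositionalEquality as ≡
open import Relation.Binary.PropositionalEquality
  using (_≡_; refl; sym; trans; cong; cong₂; subst; subst₂; module ≡-Reasoning)

open Equivalence using (to; from)

private
  variable
    A B : Set

if-true : ∀ {ℓ} {X : Set ℓ} {b} {x y : X} → T b → (if b then x else y) ≡ x
if-true {b = true} _ = refl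

if-false : ∀ {ℓ} {X : Set ℓ} {b} {x y : X} → ¬ T b → (if b then x else y) ≡ y
if-false {b = false} _  = refl
if-false {b = true}  ¬t = contradiction tt ¬t

if-cong : ∀ {ℓ} {X : Set ℓ} {x y : Bool} {u v z : X} →
          (T x ⇔ T y) → (T x → u ≡ v) → (if x then u else z) ≡ (if y then v else z)
if-cong {x = true}  {true}  _   u≡v = u≡v tt
if-cong {x = true}  {false} x⇔y _   = ⊥-elim (to x⇔y tt)
if-cong {x = false} {true}  x⇔y _   = ⊥-elim (from x⇔y tt)
if-cong {x = false} {false} _   _   = refl

nonempty⇔∈ : {xs : List A} → T (not (null xs)) ⇔ ∃ λ x → x ∈ xs
nonempty⇔∈ {xs = []}     = mk⇔ (λ ()) (λ ())
nonempty⇔∈ {xs = x ∷ xs} = mk⇔ (λ _ → x , here refl) (λ _ → tt)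

allB⁻ : ∀ (p : A → Bool) {xs x} → T (allB p xs) → x ∈ xs → T (p x)
allB⁻ p {x ∷ xs} h (here refl) = proj₁ (to T-∧ h)
allB⁻ p {x ∷ xs} h (there x∈)  = allB⁻ p (proj₂ (to (T-∧ {p x}) h)) x∈

allB⁺ : ∀ (p : A → Bool) xs → (∀ {x} → x ∈ xs → T (p x)) → T (allB p xs)
allB⁺ p []       h = tt
allB⁺ p (x ∷ xs) h = from T-∧ (h (here refl) , allB⁺ p xs (h ∘ there))

allB-upTo⁻ : ∀ (p : ℕ → Bool) {m i} → T (allB p (upTo m)) → i < m → T (p i)
allB-upTo⁻ p h i<m = allB⁻ p h (∈-upTo⁺ i<m)

allB-upTo⁺ : ∀ (p : ℕ → Bool) m → (∀ {i} → i < m → T (p i)) → T (allB p (upTo m))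
allB-upTo⁺ p m h = allB⁺ p (upTo m) (λ i∈ → h (∈-upTo⁻ i∈))

filterᵇ-cong : ∀ {p q : A → Bool} xs → (∀ {x} → x ∈ xs → p x ≡ q x) →
               filterᵇ p xs ≡ filterᵇ q xs
filterᵇ-cong {p = p} {q} []       _   = refl
filterᵇ-cong {p = p} {q} (x ∷ xs) p≡q with p x | q x | p≡q (here refl)
... | true  | true  | _ = cong (x ∷_) (filterᵇ-cong xs (p≡q ∘ there))
... | false | false | _ = filterᵇ-cong xs (p≡q ∘ there)

length-filterᵇ-[_] : ∀ {p : A → Bool} x → length (filterᵇ p (x ∷ [])) ≡ (if p x then 1 else 0)
length-filterᵇ-[_] {p = p} x with p x
... | true  = refl
... | false = refl

nth-++ : ∀ w ys {p} → p < length w → nth (w ++ ys) p ≡ nth w p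
nth-++ (x ∷ w) ys {zero}  _  = refl
nth-++ (x ∷ w) ys {suc p} p< = nth-++ w ys (s≤s⁻¹ p<)

nth-++-length : ∀ w b → nth (w ++ b ∷ []) (length w) ≡ b
nth-++-length []      b = refl
nth-++-length (x ∷ w) b = nth-++-length w b

map-nth-upTo : ∀ w → map (nth w) (upTo (length w)) ≡ w
map-nth-upTo []      = refl
map-nth-upTo (x ∷ w) = cong (x ∷_) (begin
  map (nth (x ∷ w)) (applyUpTo suc (length w))
    ≡⟨ cong (map (nth (x ∷ w))) (sym (List.map-upTo suc (length w))) ⟩
  map (nth (x ∷ w)) (map suc (upTo (length w)))
    ≡⟨ sym (List.map-∘ (upTo (length w))) ⟩
  map (nth w) (upTo (length w))
    ≡⟨ map-nth-upTo w ⟩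
  w ∎)
  where open ≡-Reasoning

minL-∈ : ∀ {xs : List ℕ} {y} → y ∈ xs → minL xs ∈ xs
minL-∈ {x ∷ xs} _ with foldr-selective ⊓-sel x xs
... | inj₁ eq = here eq
... | inj₂ m∈ = there m∈

minL≤xs : ∀ xs → All (minL xs ≤_) xs
minL≤xs []       = []
minL≤xs (x ∷ xs) = go x xs
  where
  go : ∀ x xs → All (foldr _⊓_ x xs ≤_) (x ∷ xs)
  go x []       = ≤-refl ∷ []
  go x (y ∷ ys) with go x ys
  ... | m≤x ∷ m≤ys = ≤-trans (m⊓n≤n y _) m≤x ∷ m⊓n≤m y _
                   ∷ All.map (≤-trans (m⊓n≤n y _)) m≤ys

minL-unique : ∀ {xs m} → m ∈ xs → All (m ≤_) xs → minL xs ≡ m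
minL-unique {xs} m∈ m≤ = ≤-antisym (All.lookup (minL≤xs xs) m∈) (All.lookup m≤ (minL-∈ m∈))

minL≤ : ∀ {xs n} → All (_≤ n) xs → minL xs ≤ n
minL≤ {[]}     _  = z≤n
minL≤ {x ∷ xs} ≤n = All.lookup ≤n (minL-∈ (here refl))

-- Finite sums in a commutative semiring

module Sums {c ℓ} (R : CommutativeSemiring c ℓ) where

  private module R = CommutativeSemiring R
  open R using (Carrier; _≈_; 0#) renaming (_+_ to _⊕_; _*_ to _⊛_)
  open SetoidReasoning R.setoid
  open CommutativeSemigroupProperties (CommutativeMonoid.commutativeSemigroup R.+-commutativeMonoid)
    using (interchange)

  ∑ : List A → (A → Carrier) → Carrier
  ∑ xs f = foldr (λ x acc → f x ⊕ acc) 0# xs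

  syntax ∑ xs (λ x → e) = ∑[ x ← xs ] e

  ∑-cong : ∀ (xs : List A) {f g} → (∀ {x} → x ∈ xs → f x ≈ g x) → ∑ xs f ≈ ∑ xs g
  ∑-cong []       f≈g = R.refl
  ∑-cong (x ∷ xs) f≈g = R.+-cong (f≈g (here ≡.refl)) (∑-cong xs (f≈g ∘ there))

  ∑-zero : ∀ (xs : List A) → ∑[ x ← xs ] 0# ≈ 0#
  ∑-zero []       = R.refl
  ∑-zero (x ∷ xs) = R.trans (R.+-identityˡ _) (∑-zero xs)

  ∑-++ : ∀ (xs ys : List A) f → ∑ (xs ++ ys) f ≈ ∑ xs f ⊕ ∑ ys f
  ∑-++ []       ys f = R.sym (R.+-identityˡ _)
  ∑-++ (x ∷ xs) ys f = R.trans (R.+-cong R.refl (∑-++ xs ys f)) (R.sym (R.+-assoc _ _ _))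

  ∑-+ : ∀ (xs : List A) f g → ∑[ x ← xs ] (f x ⊕ g x) ≈ ∑ xs f ⊕ ∑ xs g
  ∑-+ []       f g = R.sym (R.+-identityˡ 0#)
  ∑-+ (x ∷ xs) f g = R.trans (R.+-cong R.refl (∑-+ xs f g)) (interchange _ _ _ _)

  ∑-*ˡ : ∀ (xs : List A) a f → ∑[ x ← xs ] (a ⊛ f x) ≈ a ⊛ ∑ xs f
  ∑-*ˡ []       a f = R.sym (R.zeroʳ a)
  ∑-*ˡ (x ∷ xs) a f = R.trans (R.+-cong R.refl (∑-*ˡ xs a f)) (R.sym (R.distribˡ a _ _))

  ∑-filter : ∀ p (xs : List A) f → ∑ (filterᵇ p xs) f ≈ ∑[ x ← xs ] (if p x then f x else 0#)
  ∑-filter p []       f = R.refl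
  ∑-filter p (x ∷ xs) f with p x
  ... | true  = R.+-cong R.refl (∑-filter p xs f)
  ... | false = R.trans (∑-filter p xs f) (R.sym (R.+-identityˡ _))

  ∑-comm : ∀ (xs : List A) (ys : List B) (f : A → B → Carrier) →
           ∑[ x ← xs ] ∑[ y ← ys ] f x y ≈ ∑[ y ← ys ] ∑[ x ← xs ] f x y
  ∑-comm []       ys f = R.sym (∑-zero ys)
  ∑-comm (x ∷ xs) ys f =
    R.trans (R.+-cong R.refl (∑-comm xs ys f)) (R.sym (∑-+ ys (f x) (λ y → ∑[ x ← xs ] f x y)))

  ∑-map : ∀ (h : B → A) xs f → ∑ (map h xs) f ≡ ∑[ x ← xs ] f (h x)
  ∑-map h []       f = ≡.refl
  ∑-map h (x ∷ xs) f = ≡.cong (f (h x) ⊕_) (∑-map h xs f)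

  ∑-concatMap : ∀ (h : B → List A) xs f → ∑ (concatMap h xs) f ≈ ∑[ x ← xs ] ∑ (h x) f
  ∑-concatMap h []       f = R.refl
  ∑-concatMap h (x ∷ xs) f = R.trans (∑-++ (h x) _ f) (R.+-cong R.refl (∑-concatMap h xs f))

  ∑-upTo-suc : ∀ m f → ∑ (upTo (suc m)) f ≈ ∑ (upTo m) f ⊕ f m
  ∑-upTo-suc m f = begin
    ∑ (upTo (suc m)) f          ≡⟨ ≡.cong (λ xs → ∑ xs f) (≡.sym (List.upTo-∷ʳ m)) ⟩
    ∑ (upTo m ++ m ∷ []) f      ≈⟨ ∑-++ (upTo m) (m ∷ []) f ⟩
    ∑ (upTo m) f ⊕ (f m ⊕ 0#)   ≈⟨ R.+-cong R.refl (R.+-identityʳ (f m)) ⟩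
    ∑ (upTo m) f ⊕ f m          ∎

  ∑-upTo-indicator : ∀ {m i} v → i < m → ∑[ j ← upTo m ] (if j ≡ᵇ i then v else 0#) ≈ v
  ∑-upTo-indicator {suc m} {i} v i<1+m with m≤n⇒m<n∨m≡n (s≤s⁻¹ i<1+m)
  ... | inj₁ i<m = begin
    ∑[ j ← upTo (suc m) ] δ j   ≈⟨ ∑-upTo-suc m δ ⟩
    ∑[ j ← upTo m ] δ j ⊕ δ m   ≈⟨ R.+-cong (∑-upTo-indicator v i<m)
                                            (R.reflexive (if-false (<⇒≢ i<m ∘ ≡.sym ∘ ≡ᵇ⇒≡ m i))) ⟩
    v ⊕ 0#                      ≈⟨ R.+-identityʳ v ⟩
    v                           ∎
    where
    δ : ℕ → Carrier
    δ j = if j ≡ᵇ i then v else 0#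
  ... | inj₂ ≡.refl = begin
    ∑[ j ← upTo (suc m) ] δ j   ≈⟨ ∑-upTo-suc m δ ⟩
    ∑[ j ← upTo m ] δ j ⊕ δ m   ≈⟨ R.+-cong (∑-cong (upTo m) (R.reflexive ∘ if-false ∘ j≢m))
                                            (R.reflexive (if-true (≡⇒≡ᵇ m m ≡.refl))) ⟩
    ∑[ j ← upTo m ] 0# ⊕ v      ≈⟨ R.+-cong (∑-zero (upTo m)) R.refl ⟩
    0# ⊕ v                      ≈⟨ R.+-identityˡ v ⟩
    v                           ∎
    where
    δ : ℕ → Carrier
    δ j = if j ≡ᵇ m then v else 0#
    j≢m : ∀ {j} → j ∈ upTo m → ¬ T (j ≡ᵇ m)
    j≢m j∈ = <⇒≢ (∈-upTo⁻ j∈) ∘ ≡ᵇ⇒≡ _ m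

  ∑-upTo-≤ : ∀ {m m′} f → m ≤ m′ →
             ∑ (upTo m) f ≈ ∑[ j ← upTo m′ ] (if j <ᵇ m then f j else 0#)
  ∑-upTo-≤ {m} {zero}   f z≤n = R.refl
  ∑-upTo-≤ {m} {suc m′} f m≤ with m≤n⇒m<n∨m≡n m≤
  ... | inj₂ ≡.refl = ∑-cong (upTo m) (λ j∈ → R.reflexive (≡.sym (if-true (<⇒<ᵇ (∈-upTo⁻ j∈)))))
  ... | inj₁ m<1+m′ = begin
    ∑ (upTo m) f                 ≈⟨ ∑-upTo-≤ f (s≤s⁻¹ m<1+m′) ⟩
    ∑[ j ← upTo m′ ] g j         ≈⟨ R.sym (R.+-identityʳ _) ⟩
    ∑[ j ← upTo m′ ] g j ⊕ 0#    ≈⟨ R.+-cong R.refl (R.reflexive (≡.sym (if-false m′≮m))) ⟩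
    ∑[ j ← upTo m′ ] g j ⊕ g m′  ≈⟨ R.sym (∑-upTo-suc m′ g) ⟩
    ∑[ j ← upTo (suc m′) ] g j   ∎
    where
    g : ℕ → Carrier
    g j = if j <ᵇ m then f j else 0#
    m′≮m : ¬ T (m′ <ᵇ m)
    m′≮m t = <⇒≱ (<ᵇ⇒< m′ m t) (s≤s⁻¹ m<1+m′)

  ∑-words-suc : ∀ L b f → ∑ (words (suc L) b) f ≈ ∑[ v ← words L b ] ∑[ c ← upTo b ] f (c ∷ v)
  ∑-words-suc L b f = R.trans (∑-concatMap _ (words L b) f)
                              (∑-cong (words L b) (λ {v} _ → R.reflexive (∑-map (_∷ v) (upTo b) f)))

  ∑-words-snoc : ∀ L b f →
                 ∑ (words (suc L) b) f ≈ ∑[ w ← words L b ] ∑[ c ← upTo b ] f (w ++ c ∷ [])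
  ∑-words-snoc zero    b f = ∑-words-suc 0 b f
  ∑-words-snoc (suc L) b f = begin
    ∑ (words (suc (suc L)) b) f
      ≈⟨ ∑-words-suc (suc L) b f ⟩
    ∑[ v ← words (suc L) b ] ∑[ a ← upTo b ] f (a ∷ v)
      ≈⟨ ∑-words-snoc L b _ ⟩
    ∑[ w ← words L b ] ∑[ c ← upTo b ] ∑[ a ← upTo b ] f (a ∷ w ++ c ∷ [])
      ≈⟨ ∑-cong (words L b) (λ {w} _ → ∑-comm (upTo b) (upTo b) (λ c a → f (a ∷ w ++ c ∷ []))) ⟩
    ∑[ w ← words L b ] ∑[ a ← upTo b ] ∑[ c ← upTo b ] f (a ∷ w ++ c ∷ [])
      ≈⟨ R.sym (∑-words-suc L b _) ⟩
    ∑[ w ← words (suc L) b ] ∑[ c ← upTo b ] f (w ++ c ∷ [])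
      ∎

  ∑-words-≤ : ∀ L {b b′} f → b ≤ b′ →
              ∑ (words L b) f ≈ ∑[ w ← words L b′ ] (if allB (_<ᵇ b) w then f w else 0#)
  ∑-words-≤ zero    f b≤b′ = R.refl
  ∑-words-≤ (suc L) {b} {b′} f b≤b′ = begin
    ∑ (words (suc L) b) f
      ≈⟨ ∑-words-suc L b f ⟩
    ∑[ v ← words L b ] ∑[ c ← upTo b ] f (c ∷ v)
      ≈⟨ ∑-words-≤ L _ b≤b′ ⟩
    ∑[ v ← words L b′ ] (if allB (_<ᵇ b) v then ∑[ c ← upTo b ] f (c ∷ v) else 0#)
      ≈⟨ ∑-cong (words L b′) (λ {v} _ → restrict v) ⟩
    ∑[ v ← words L b′ ] ∑[ c ← upTo b′ ] g (c ∷ v)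
      ≈⟨ R.sym (∑-words-suc L b′ g) ⟩
    ∑ (words (suc L) b′) g
      ∎
    where
    g : List ℕ → Carrier
    g w = if allB (_<ᵇ b) w then f w else 0#
    restrict : ∀ v → (if allB (_<ᵇ b) v then ∑[ c ← upTo b ] f (c ∷ v) else 0#)
                     ≈ ∑[ c ← upTo b′ ] g (c ∷ v)
    restrict v with allB (_<ᵇ b) v
    ... | true  = R.trans (∑-upTo-≤ _ b≤b′)
                          (∑-cong (upTo b′) (λ {c} _ → R.reflexive (≡.cong (if_then f (c ∷ v) else 0#)
                                                                               (≡.sym (∧-identityʳ (c <ᵇ b))))))
    ... | false = R.sym (R.trans (∑-cong (upTo b′) (λ {c} _ → R.reflexive (≡.cong (if_then f (c ∷ v) else 0#)
                                                                                   (∧-zeroʳ (c <ᵇ b)))))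
                                 (∑-zero (upTo b′)))

module _ where
  open Sums +-*-commutativeSemiring using (∑; ∑-upTo-suc)

  ∑-upTo-[<ᵇ] : ∀ m b → ∑[ j ← upTo m ] (if b <ᵇ j then 1 else 0) ≡ m ∸ suc b
  ∑-upTo-[<ᵇ] zero    b = refl
  ∑-upTo-[<ᵇ] (suc m) b =
    trans (∑-upTo-suc m _) (trans (cong (_+ (if b <ᵇ m then 1 else 0)) (∑-upTo-[<ᵇ] m b)) (step m b))
    where
    step : ∀ m b → m ∸ suc b + (if b <ᵇ m then 1 else 0) ≡ m ∸ b
    step zero    zero    = refl
    step zero    (suc b) = refl
    step (suc m) zero    = +-comm m 1
    step (suc m) (suc b) = step m b

∈-words⁻ : ∀ {L b w} → w ∈ words L b → length w ≡ L × All (_< b) w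
∈-words⁻ {zero}      (here refl) = refl , []
∈-words⁻ {suc L} {b} w∈ with ∈-concat⁻′ (map (λ v → map (_∷ v) (upTo b)) (words L b)) w∈
... | cs , w∈cs , cs∈ with ∈-map⁻ (λ v → map (_∷ v) (upTo b)) cs∈
...   | v , v∈ , refl with ∈-map⁻ (_∷ v) w∈cs
...     | c , c∈ , refl = let |v| , v<b = ∈-words⁻ v∈ in cong suc |v| , ∈-upTo⁻ c∈ ∷ v<b

+-⊖-cancelʳ : ∀ m n → (m + n) ⊖ n ≡ + m
+-⊖-cancelʳ m n = trans (cong₂ _⊖_ (+-comm m n) (sym (+-identityʳ n))) (ℤ.+-cancelˡ-⊖ n m 0)

elems-suc : ∀ n → elems (suc n) ≡ -[1+ n ] ∷ elems n ++ + suc n ∷ []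
elems-suc n = cong (-[1+ n ] ∷_) (begin
  map (_⊖ suc n) (applyUpTo suc (2 * suc n))
    ≡⟨ cong (map (_⊖ suc n)) (sym (List.map-upTo suc (2 * suc n))) ⟩
  map (_⊖ suc n) (map suc (upTo (2 * suc n)))
    ≡⟨ sym (List.map-∘ (upTo (2 * suc n))) ⟩
  map (λ p → suc p ⊖ suc n) (upTo (2 * suc n))
    ≡⟨ List.map-cong (λ p → ℤ.[1+m]⊖[1+n]≡m⊖n p n) (upTo (2 * suc n)) ⟩
  map (_⊖ n) (upTo (2 * suc n))
    ≡⟨ cong (map (_⊖ n)) (trans (cong upTo (*-suc 2 n)) (sym (List.upTo-∷ʳ (suc (2 * n))))) ⟩
  map (_⊖ n) (upTo (suc (2 * n)) ++ suc (2 * n) ∷ [])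
    ≡⟨ List.map-++ (_⊖ n) (upTo (suc (2 * n))) _ ⟩
  elems n ++ suc (2 * n) ⊖ n ∷ []
    ≡⟨ cong (λ m → elems n ++ m ⊖ n ∷ []) (cong (λ m → suc (n + m)) (+-identityʳ n)) ⟩
  elems n ++ (suc n + n) ⊖ n ∷ []
    ≡⟨ cong (λ x → elems n ++ x ∷ []) (+-⊖-cancelʳ (suc n) n) ⟩
  elems n ++ + suc n ∷ [] ∎)
  where open ≡-Reasoning

∈-elems-suc⁻ : ∀ {n x} → x ∈ elems (suc n) → x ≡ -[1+ n ] ⊎ x ∈ elems n ⊎ x ≡ + suc n
∈-elems-suc⁻ {n} {x} x∈ with subst (x ∈_) (elems-suc n) x∈
... | here eq = inj₁ eq
... | there x∈′ with ∈-++⁻ (elems n) x∈′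
...   | inj₁ x∈n       = inj₂ (inj₁ x∈n)
...   | inj₂ (here eq) = inj₂ (inj₂ eq)

∈-elems-suc⁺ : ∀ {n x} → x ≡ -[1+ n ] ⊎ x ∈ elems n ⊎ x ≡ + suc n → x ∈ elems (suc n)
∈-elems-suc⁺ {n} {x} h = subst (x ∈_) (sym (elems-suc n)) (go h)
  where
  go : x ≡ -[1+ n ] ⊎ x ∈ elems n ⊎ x ≡ + suc n → x ∈ -[1+ n ] ∷ elems n ++ + suc n ∷ []
  go (inj₁ refl)        = here refl
  go (inj₂ (inj₁ x∈n))  = there (∈-++⁺ˡ x∈n)
  go (inj₂ (inj₂ refl)) = there (∈-++⁺ʳ (elems n) (here refl))

∈-elems⇒∣∣≤ : ∀ {n x} → x ∈ elems n → ∣ x ∣ ≤ n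
∈-elems⇒∣∣≤ {zero}  (here refl) = z≤n
∈-elems⇒∣∣≤ {suc n} x∈ with ∈-elems-suc⁻ x∈
... | inj₁ refl        = ≤-refl
... | inj₂ (inj₁ x∈n)  = m≤n⇒m≤1+n (∈-elems⇒∣∣≤ x∈n)
... | inj₂ (inj₂ refl) = ≤-refl

neg-∈-elems : ∀ {n x} → x ∈ elems n → - x ∈ elems n
neg-∈-elems {zero}  (here refl) = here refl
neg-∈-elems {suc n} x∈ with ∈-elems-suc⁻ x∈
... | inj₁ refl        = ∈-elems-suc⁺ (inj₂ (inj₂ refl))
... | inj₂ (inj₁ x∈n)  = ∈-elems-suc⁺ (inj₂ (inj₁ (neg-∈-elems {n} x∈n)))
... | inj₂ (inj₂ refl) = ∈-elems-suc⁺ (inj₁ refl)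

+-∈-elems : ∀ {m n} → m ≤ n → + m ∈ elems n
+-∈-elems {n = zero}  z≤n = here refl
+-∈-elems {n = suc n} m≤ with m≤n⇒m<n∨m≡n m≤
... | inj₁ m<   = ∈-elems-suc⁺ (inj₂ (inj₁ (+-∈-elems (≤-pred m<))))
... | inj₂ refl = ∈-elems-suc⁺ (inj₂ (inj₂ refl))

∈-elems⁻ : ∀ {n x} → x ∈ elems n → ∃[ p ] p < suc (2 * n) × x ≡ p ⊖ n
∈-elems⁻ {n} x∈ with ∈-map⁻ (_⊖ n) x∈
... | p , p∈ , refl = p , ∈-upTo⁻ p∈ , refl

lab-⊖ : ∀ n w p → lab n w (p ⊖ n) ≡ nth w p
lab-⊖ n w p = cong (nth w ∘ ∣_∣) (trans (ℤ.distribˡ-⊖-+-pos n p n) (+-⊖-cancelʳ p n))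

labels-elems : ∀ n w → length w ≡ suc (2 * n) → map (lab n w) (elems n) ≡ w
labels-elems n w |w| = begin
  map (lab n w) (map (_⊖ n) (upTo (suc (2 * n))))   ≡⟨ sym (List.map-∘ (upTo (suc (2 * n)))) ⟩
  map (λ p → lab n w (p ⊖ n)) (upTo (suc (2 * n)))  ≡⟨ List.map-cong (lab-⊖ n w) (upTo (suc (2 * n))) ⟩
  map (nth w) (upTo (suc (2 * n)))                  ≡⟨ cong (map (nth w) ∘ upTo) (sym |w|) ⟩
  map (nth w) (upTo (length w))                     ≡⟨ map-nth-upTo w ⟩
  w                                                 ∎
  where open ≡-Reasoning

∈-block⁻ : ∀ {n w j x} → x ∈ block n w j → x ∈ elems n × lab n w x ≡ j
∈-block⁻ {n} {w} {j} {x} x∈ with ∈-filter⁻ (T? ∘ λ y → lab n w y ≡ᵇ j) x∈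
... | x∈n , eq = x∈n , ≡ᵇ⇒≡ (lab n w x) j eq

∈-block⁺ : ∀ {n w j x} → x ∈ elems n → lab n w x ≡ j → x ∈ block n w j
∈-block⁺ {n} {w} {j} {x} x∈ refl =
  ∈-filter⁺ (T? ∘ λ y → lab n w y ≡ᵇ j) x∈ (≡⇒≡ᵇ (lab n w x) j refl)

mval-≤ : ∀ n w j → mval n w j ≤ n
mval-≤ n w j = minL≤ (All.tabulate λ y∈ → bound (∈-map⁻ ∣_∣ y∈))
  where
  bound : ∀ {y} → ∃ (λ x → x ∈ block n w j × y ≡ ∣ x ∣) → y ≤ n
  bound (x , x∈ , refl) = ∈-elems⇒∣∣≤ (proj₁ (∈-block⁻ {n} {w} x∈))

module _ {n : ℕ} {w : List ℕ} (|w| : length w ≡ suc (2 * n)) where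

  ∈-labels⁻ : ∀ {j} → j ∈ w → ∃ λ x → x ∈ elems n × lab n w x ≡ j
  ∈-labels⁻ {j} j∈ with ∈-map⁻ (lab n w) (subst (j ∈_) (sym (labels-elems n w |w|)) j∈)
  ... | x , x∈ , refl = x , x∈ , refl

  ∈-labels⁺ : ∀ {x} → x ∈ elems n → lab n w x ∈ w
  ∈-labels⁺ {x} x∈ = subst (lab n w x ∈_) (labels-elems n w |w|) (∈-map⁺ (lab n w) x∈)

  block-inhabited⁺ : ∀ {j} → j ∈ w → ∃ λ x → x ∈ block n w j
  block-inhabited⁺ j∈ = let x , x∈n , eq = ∈-labels⁻ j∈ in x , ∈-block⁺ {n} {w} x∈n eq

  block-inhabited⁻ : ∀ {j x} → x ∈ block n w j → j ∈ w
  block-inhabited⁻ x∈ = let x∈n , eq = ∈-block⁻ {n} {w} x∈ in subst (_∈ w) eq (∈-labels⁺ x∈n)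

  block-nonempty⇔∈ : ∀ {j} → T (not (null (block n w j))) ⇔ j ∈ w
  block-nonempty⇔∈ =
    mk⇔ (block-inhabited⁻ ∘ proj₂ ∘ to nonempty⇔∈) (from nonempty⇔∈ ∘ block-inhabited⁺)

data PartnerView : ℕ → Set where
  isZero : PartnerView 0
  isOdd  : ∀ i → PartnerView (suc (2 * i))
  isEven : ∀ i → PartnerView (2 * suc i)

partnerView : ∀ j → PartnerView j
partnerView zero    = isZero
partnerView (suc j) with partnerView j
... | isZero   = isOdd 0
... | isOdd i  = subst PartnerView (*-suc 2 i) (isEven i)
... | isEven i = isOdd (suc i)

partner-odd : ∀ i → partner (suc (2 * i)) ≡ 2 * suc i
partner-odd i = trans (cong (λ r → if r ≡ᵇ 0 then suc (suc (2 * i)) else 2 * i) [2*i]%2≡0)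
                      (sym (*-suc 2 i))
  where
  [2*i]%2≡0 : (2 * i) % 2 ≡ 0
  [2*i]%2≡0 = trans (cong (_% 2) (*-comm 2 i)) (m*n%n≡0 i 2)

partner-even : ∀ i → partner (2 * suc i) ≡ suc (2 * i)
partner-even i = trans (cong partner (*-suc 2 i))
                       (cong (λ r → if r ≡ᵇ 0 then suc (suc (suc (2 * i))) else suc (2 * i)) [1+2*i]%2≡1)
  where
  [1+2*i]%2≡1 : suc (2 * i) % 2 ≡ 1
  [1+2*i]%2≡1 = trans (cong (λ m → suc m % 2) (*-comm 2 i)) ([m+kn]%n≡m%n 1 i 2)

partner-involutive : ∀ j → partner (partner j) ≡ j
partner-involutive j with partnerView j
... | isZero   = refl
... | isOdd i  = trans (cong partner (partner-odd i)) (partner-even i)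
... | isEven i = trans (cong partner (partner-even i)) (partner-odd i)

odd<even : ∀ i → suc (2 * i) < 2 * suc i
odd<even i = subst (suc (2 * i) <_) (sym (*-suc 2 i)) (n<1+n _)

even-index< : ∀ {i k} → i < k → 2 * suc i < suc (2 * k)
even-index< i<k = s≤s (*-monoʳ-≤ 2 i<k)

even-index<⁻ : ∀ {i k} → 2 * suc i < suc (2 * k) → i < k
even-index<⁻ lt = *-cancelˡ-≤ 2 (s≤s⁻¹ lt)

partner-< : ∀ {j k} → j < suc (2 * k) → partner j < suc (2 * k)
partner-< {j} {k} j< with partnerView j
... | isZero   = j<
... | isOdd i  = subst (_< suc (2 * k)) (sym (partner-odd i)) (even-index< (*-cancelˡ-< 2 i k (s≤s⁻¹ j<)))
... | isEven i = subst (_< suc (2 * k)) (sym (partner-even i)) (<-trans (odd<even i) j<)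

letters-shrink : ∀ {w i} → All (_< suc (2 * suc i)) w → suc (2 * i) ∉ w → 2 * suc i ∉ w →
                 All (_< suc (2 * i)) w
letters-shrink {w} {i} letters odd∉ even∉ = All.tabulate shrink
  where
  shrink : ∀ {j} → j ∈ w → j < suc (2 * i)
  shrink {j} j∈ with m≤n⇒m<n∨m≡n (s≤s⁻¹ (subst (j <_) (cong suc (*-suc 2 i)) (All.lookup letters j∈)))
  ... | inj₂ refl = contradiction (subst (_∈ w) (sym (*-suc 2 i)) j∈) even∉
  ... | inj₁ j<   with m≤n⇒m<n∨m≡n (s≤s⁻¹ j<)
  ...   | inj₁ j<odd = j<odd
  ...   | inj₂ refl  = contradiction j∈ odd∉

-- Standard labellings and inversions

record Standard (n k : ℕ) (w : List ℕ) : Set where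
  field
    zero∈S₀       : lab n w (+ 0) ≡ 0
    occupied      : ∀ {j} → j < suc (2 * k) → j ∈ w
    symmetric     : ∀ {x} → x ∈ elems n → lab n w (- x) ≡ partner (lab n w x)
    min∈S         : ∀ {i} → i < k → lab n w (+ mval n w (2 * suc i)) ≡ 2 * suc i
    mins-increase : ∀ {i} → suc i < k → mval n w (2 * suc i) < mval n w (2 * suc (suc i))

module _ {n k : ℕ} {w : List ℕ} (|w| : length w ≡ suc (2 * n)) where

  private
    <pred⇒suc< : ∀ {i k} → i < k ∸ 1 → suc i < k
    <pred⇒suc< {k = suc k} i< = s≤s i<

    suc<⇒<pred : ∀ {i k} → suc i < k → i < k ∸ 1
    suc<⇒<pred {k = suc k} (s≤s i<) = i<

    -- The first four conjuncts of isStd n k w: T is not injective, so T-∧ has to be told them.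
    c₁ c₂ c₃ c₄ : Bool
    c₁ = lab n w (+ 0) ≡ᵇ 0
    c₂ = allB (λ j → not (null (block n w j))) (upTo (suc (2 * k)))
    c₃ = allB (λ x → lab n w (- x) ≡ᵇ partner (lab n w x)) (elems n)
    c₄ = allB (λ i → lab n w (+ mval n w (2 * suc i)) ≡ᵇ 2 * suc i) (upTo k)

  standard⁻ : T (isStd n k w) → Standard n k w
  standard⁻ h =
    let h₁ , h₂₋₅ = to (T-∧ {c₁}) h
        h₂ , h₃₋₅ = to (T-∧ {c₂}) h₂₋₅
        h₃ , h₄₋₅ = to (T-∧ {c₃}) h₃₋₅
        h₄ , h₅   = to (T-∧ {c₄}) h₄₋₅
    in record
    { zero∈S₀       = ≡ᵇ⇒≡ _ 0 h₁
    ; occupied      = λ j< → to (block-nonempty⇔∈ |w|) (allB-upTo⁻ _ h₂ j<)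
    ; symmetric     = λ x∈ → ≡ᵇ⇒≡ _ _ (allB⁻ _ h₃ x∈)
    ; min∈S         = λ i< → ≡ᵇ⇒≡ _ _ (allB-upTo⁻ _ h₄ i<)
    ; mins-increase = λ i< → <ᵇ⇒< _ _ (allB-upTo⁻ _ h₅ (suc<⇒<pred i<))
    }

  standard⁺ : Standard n k w → T (isStd n k w)
  standard⁺ S =
    from T-∧ (≡⇒≡ᵇ _ 0 zero∈S₀ ,
    from T-∧ (allB-upTo⁺ _ _ (λ j< → from (block-nonempty⇔∈ |w|) (occupied j<)) ,
    from T-∧ (allB⁺ _ (elems n) (λ x∈ → ≡⇒≡ᵇ _ _ (symmetric x∈)) ,
    from T-∧ (allB-upTo⁺ _ k (λ i< → ≡⇒≡ᵇ _ _ (min∈S i<)) ,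
              allB-upTo⁺ _ (k ∸ 1) (λ i< → <⇒<ᵇ (mins-increase (<pred⇒suc< i<)))))))
    where open Standard S

standard⇒¬letters-shrink : ∀ {n i w} → Standard n (suc i) w → ¬ All (_< suc (2 * i)) w
standard⇒¬letters-shrink {i = i} S letters =
  <-asym (All.lookup letters (Standard.occupied S (even-index< (n<1+n i)))) (odd<even i)

¬standard-0-suc : ∀ {k w} → length w ≡ 1 → ¬ Standard 0 (suc k) w
¬standard-0-suc {k} {w} |w| S with ∈-labels⁻ {0} {w} |w| (Standard.occupied S (n<1+n (2 * suc k)))
... | _ , here refl , eq = 0≢1+n (trans (sym (Standard.zero∈S₀ S)) (trans eq (*-suc 2 k)))

partner-∈ : ∀ {n w j} → length w ≡ suc (2 * n) →
            (∀ {x} → x ∈ elems n → lab n w (- x) ≡ partner (lab n w x)) → j ∈ w → partner j ∈ w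
partner-∈ {n} {w} |w| symmetric j∈ with ∈-labels⁻ {n} {w} |w| j∈
... | x , x∈ , refl = subst (_∈ w) (symmetric x∈) (∈-labels⁺ {n} {w} |w| (neg-∈-elems {n} x∈))

isInversion : ℕ → List ℕ → ℕ → ℤ → Bool
isInversion n w j s = (lab n w s <ᵇ j) ∧ ⌊ + mval n w j ≤? s ⌋

inversions : ℕ → List ℕ → ℕ → ℕ
inversions n w j = length (filterᵇ (isInversion n w j) (elems n))

module _ where
  open Sums +-*-commutativeSemiring using (∑)

  inv≡∑inversions : ∀ n k w → inv n k w ≡ ∑ (upTo (suc (2 * k))) (inversions n w)
  inv≡∑inversions n k w = List.foldr-map _+_ (inversions n w) 0 (upTo (suc (2 * k)))

-- Adding the pair ±(n+1)

extend : ℕ → List ℕ → ℕ → List ℕ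
extend a w b = a ∷ w ++ b ∷ []

module Extension {n : ℕ} {w : List ℕ} (a b : ℕ) (|w| : length w ≡ suc (2 * n)) where

  private
    W : List ℕ
    W = extend a w b
    module ℕΣ = Sums +-*-commutativeSemiring
  open ℕΣ using (∑)

  length-extend : length W ≡ suc (2 * suc n)
  length-extend = begin
    suc (length (w ++ b ∷ []))   ≡⟨ cong suc (List.length-++ w) ⟩
    suc (length w + 1)           ≡⟨ cong (λ m → suc (m + 1)) |w| ⟩
    suc (suc (2 * n) + 1)        ≡⟨ cong suc (+-comm (suc (2 * n)) 1) ⟩
    suc (suc (suc (2 * n)))      ≡⟨ cong suc (sym (*-suc 2 n)) ⟩
    suc (2 * suc n)              ∎
    where open ≡-Reasoning

  lab-extend-inner : ∀ {x} → x ∈ elems n → lab (suc n) W x ≡ lab n w x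
  lab-extend-inner x∈ with ∈-elems⁻ {n} x∈
  ... | p , p< , refl = begin
    lab (suc n) W (p ⊖ n)           ≡⟨ cong (lab (suc n) W) (sym (ℤ.[1+m]⊖[1+n]≡m⊖n p n)) ⟩
    lab (suc n) W (suc p ⊖ suc n)   ≡⟨ lab-⊖ (suc n) W (suc p) ⟩
    nth (w ++ b ∷ []) p             ≡⟨ nth-++ w (b ∷ []) (subst (p <_) (sym |w|) p<) ⟩
    nth w p                         ≡⟨ sym (lab-⊖ n w p) ⟩
    lab n w (p ⊖ n)                 ∎
    where open ≡-Reasoning

  lab-extend-neg : lab (suc n) W -[1+ n ] ≡ a
  lab-extend-neg = lab-⊖ (suc n) W 0

  lab-extend-pos : lab (suc n) W (+ suc n) ≡ b
  lab-extend-pos = trans (cong (nth (w ++ b ∷ [])) n+1+n≡|w|) (nth-++-length w b)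
    where
    n+1+n≡|w| : n + suc n ≡ length w
    n+1+n≡|w| = trans (+-suc n n) (trans (cong (λ m → suc (n + m)) (sym (+-identityʳ n))) (sym |w|))

  ∈-extend⁺ : ∀ {j} → j ∈ w → j ∈ W
  ∈-extend⁺ j∈ = there (∈-++⁺ˡ j∈)

  ∈-extend⁻ : ∀ {j} → j ∈ W → j ≡ a ⊎ j ∈ w ⊎ j ≡ b
  ∈-extend⁻ (here eq) = inj₁ eq
  ∈-extend⁻ (there j∈) with ∈-++⁻ w j∈
  ... | inj₁ j∈w       = inj₂ (inj₁ j∈w)
  ... | inj₂ (here eq) = inj₂ (inj₂ eq)

  ∈-block-extend⁺ : ∀ {j x} → x ∈ block n w j → x ∈ block (suc n) W j
  ∈-block-extend⁺ x∈ with ∈-block⁻ {n} {w} x∈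
  ... | x∈n , refl = ∈-block⁺ {suc n} {W} (∈-elems-suc⁺ (inj₂ (inj₁ x∈n))) (lab-extend-inner x∈n)

  ∈-block-extend⁻ : ∀ {j x} → x ∈ block (suc n) W j →
                    (x ≡ -[1+ n ] × a ≡ j) ⊎ x ∈ block n w j ⊎ (x ≡ + suc n × b ≡ j)
  ∈-block-extend⁻ x∈ with ∈-block⁻ {suc n} {W} x∈
  ... | x∈N , refl with ∈-elems-suc⁻ {n} x∈N
  ...   | inj₁ refl        = inj₁ (refl , sym lab-extend-neg)
  ...   | inj₂ (inj₁ x∈n)  = inj₂ (inj₁ (∈-block⁺ {n} {w} x∈n (sym (lab-extend-inner x∈n))))
  ...   | inj₂ (inj₂ refl) = inj₂ (inj₂ (refl , sym lab-extend-pos))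

  mval-extend-old : ∀ {j} → j ∈ w → mval (suc n) W j ≡ mval n w j
  mval-extend-old {j} j∈ = minL-unique m∈ (All.tabulate (λ y∈ → m≤ (∈-map⁻ ∣_∣ y∈)))
    where
    m : ℕ
    m = mval n w j
    m∈ : m ∈ map ∣_∣ (block (suc n) W j)
    m∈ with ∈-map⁻ ∣_∣ (minL-∈ (∈-map⁺ ∣_∣ (proj₂ (block-inhabited⁺ |w| j∈))))
    ... | y , y∈ , m≡ = subst (_∈ _) (sym m≡) (∈-map⁺ ∣_∣ (∈-block-extend⁺ y∈))
    m≤ : ∀ {y} → ∃ (λ x → x ∈ block (suc n) W j × y ≡ ∣ x ∣) → m ≤ y
    m≤ (x , x∈ , refl) with ∈-block-extend⁻ x∈
    ... | inj₁ (refl , _)        = m≤n⇒m≤1+n (mval-≤ n w j)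
    ... | inj₂ (inj₁ x∈old)      = All.lookup (minL≤xs _) (∈-map⁺ ∣_∣ x∈old)
    ... | inj₂ (inj₂ (refl , _)) = m≤n⇒m≤1+n (mval-≤ n w j)

  mval-extend-new : ∀ {j} → j ∉ w → a ≡ j ⊎ b ≡ j → mval (suc n) W j ≡ suc n
  mval-extend-new {j} j∉ a∨b = minL-unique (new∈ a∨b) (All.tabulate (λ y∈ → n<y (∈-map⁻ ∣_∣ y∈)))
    where
    new∈ : a ≡ j ⊎ b ≡ j → suc n ∈ map ∣_∣ (block (suc n) W j)
    new∈ (inj₁ refl) =
      ∈-map⁺ ∣_∣ (∈-block⁺ {suc n} {W} (∈-elems-suc⁺ (inj₁ refl)) lab-extend-neg)
    new∈ (inj₂ refl) =
      ∈-map⁺ ∣_∣ (∈-block⁺ {suc n} {W} (∈-elems-suc⁺ (inj₂ (inj₂ refl))) lab-extend-pos)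
    n<y : ∀ {y} → ∃ (λ x → x ∈ block (suc n) W j × y ≡ ∣ x ∣) → suc n ≤ y
    n<y (x , x∈ , refl) with ∈-block-extend⁻ x∈
    ... | inj₁ (refl , _)        = ≤-refl
    ... | inj₂ (inj₁ x∈old)      = contradiction (block-inhabited⁻ |w| x∈old) j∉
    ... | inj₂ (inj₂ (refl , _)) = ≤-refl

  lab-mval-extend : ∀ {j} → j ∈ w → lab (suc n) W (+ mval (suc n) W j) ≡ lab n w (+ mval n w j)
  lab-mval-extend {j} j∈ = trans (cong (λ m → lab (suc n) W (+ m)) (mval-extend-old j∈))
                                 (lab-extend-inner (+-∈-elems (mval-≤ n w j)))

  -- -(n+1) is never an inversion since all minima are ≥ 0, and n+1 ∈ S_b is one for S_j iff b < j.
  inversions-extend : ∀ j → inversions (suc n) W j ≡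
                      length (filterᵇ (isInversion (suc n) W j) (elems n)) + (if b <ᵇ j then 1 else 0)
  inversions-extend j = begin
    length (filterᵇ P (elems (suc n)))
      ≡⟨ cong (length ∘ filterᵇ P) (elems-suc n) ⟩
    length (filterᵇ P (-[1+ n ] ∷ elems n ++ + suc n ∷ []))
      ≡⟨ cong length (List.filter-reject (T? ∘ P) ¬P-neg) ⟩
    length (filterᵇ P (elems n ++ + suc n ∷ []))
      ≡⟨ cong length (List.filter-++ (T? ∘ P) (elems n) _) ⟩
    length (filterᵇ P (elems n) ++ filterᵇ P (+ suc n ∷ []))
      ≡⟨ List.length-++ (filterᵇ P (elems n)) ⟩
    length (filterᵇ P (elems n)) + length (filterᵇ P (+ suc n ∷ []))
      ≡⟨ cong₂ _+_ refl (trans (length-filterᵇ-[_] {p = P} (+ suc n)) (cong (if_then 1 else 0) P-pos)) ⟩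
    length (filterᵇ P (elems n)) + (if b <ᵇ j then 1 else 0)
      ∎
    where
    open ≡-Reasoning
    P : ℤ → Bool
    P = isInversion (suc n) W j
    ¬P-neg : ¬ T (P -[1+ n ])
    ¬P-neg t = proj₂ (to (T-∧ {lab (suc n) W -[1+ n ] <ᵇ j}) t)
    P-pos : P (+ suc n) ≡ (b <ᵇ j)
    P-pos = trans (cong₂ _∧_ (cong (_<ᵇ j) lab-extend-pos)
                             (to T-≡ (fromWitness (+≤+ (mval-≤ (suc n) W j)))))
                  (∧-identityʳ (b <ᵇ j))

  inversions-extend-old : ∀ {j} → j ∈ w →
                          inversions (suc n) W j ≡ inversions n w j + (if b <ᵇ j then 1 else 0)
  inversions-extend-old {j} j∈ =
    trans (inversions-extend j) (cong (_+ _) (cong length (filterᵇ-cong (elems n) same)))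
    where
    same : ∀ {x} → x ∈ elems n → isInversion (suc n) W j x ≡ isInversion n w j x
    same {x} x∈ = cong₂ _∧_ (cong (_<ᵇ j) (lab-extend-inner x∈))
                            (cong (λ m → ⌊ + m ≤? x ⌋) (mval-extend-old j∈))

  inversions-extend-new : ∀ {j} → j ∉ w → a ≡ j ⊎ b ≡ j →
                          inversions (suc n) W j ≡ (if b <ᵇ j then 1 else 0)
  inversions-extend-new {j} j∉ a∨b =
    trans (inversions-extend j)
          (cong (_+ _) (cong length (List.filter-none (T? ∘ isInversion (suc n) W j) (All.tabulate none))))
    where
    none : ∀ {x} → x ∈ elems n → ¬ T (isInversion (suc n) W j x)
    none {x} x∈ t with toWitness (proj₂ (to (T-∧ {lab (suc n) W x <ᵇ j}) t))
    ... | +≤+ m≤x =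
      <⇒≱ (s≤s (∈-elems⇒∣∣≤ x∈)) (subst (_≤ ∣ x ∣) (mval-extend-new j∉ a∨b) m≤x)

  inv-extend-old : ∀ {k} → (∀ {j} → j < suc (2 * k) → j ∈ w) →
                   inv (suc n) k W ≡ inv n k w + (2 * k ∸ b)
  inv-extend-old {k} occupied = begin
    inv (suc n) k W
      ≡⟨ inv≡∑inversions (suc n) k W ⟩
    ∑ U (inversions (suc n) W)
      ≡⟨ ℕΣ.∑-cong U (λ j∈ → inversions-extend-old (occupied (∈-upTo⁻ j∈))) ⟩
    ∑[ j ← U ] (inversions n w j + (if b <ᵇ j then 1 else 0))
      ≡⟨ ℕΣ.∑-+ U (inversions n w) _ ⟩
    ∑ U (inversions n w) + ∑[ j ← U ] (if b <ᵇ j then 1 else 0)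
      ≡⟨ cong₂ _+_ (sym (inv≡∑inversions n k w)) (∑-upTo-[<ᵇ] (suc (2 * k)) b) ⟩
    inv n k w + (2 * k ∸ b)
      ∎
    where
    open ≡-Reasoning
    U = upTo (suc (2 * k))

  inv-extend-new : ∀ {i} → a ≡ suc (2 * i) → b ≡ 2 * suc i → a ∉ w → b ∉ w →
                   (∀ {j} → j < suc (2 * i) → j ∈ w) → inv (suc n) (suc i) W ≡ inv n i w
  inv-extend-new {i} a≡ b≡ a∉ b∉ occupied = begin
    inv (suc n) (suc i) W            ≡⟨ inv≡∑inversions (suc n) (suc i) W ⟩
    ∑ (upTo (suc (2 * suc i))) F     ≡⟨ cong (λ m → ∑ (upTo (suc m)) F) (*-suc 2 i) ⟩
    ∑ (upTo (suc (suc o))) F         ≡⟨ ℕΣ.∑-upTo-suc (suc o) F ⟩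
    ∑ (upTo (suc o)) F + F (suc o)   ≡⟨ cong (_+ F (suc o)) (ℕΣ.∑-upTo-suc o F) ⟩
    ∑ (upTo o) F + F o + F (suc o)   ≡⟨ cong₂ _+_ (cong₂ _+_ old (F≡0 (inj₁ a≡)))
                                                  (F≡0 (inj₂ b≡′)) ⟩
    inv n i w + 0 + 0                ≡⟨ trans (+-identityʳ _) (+-identityʳ _) ⟩
    inv n i w                        ∎
    where
    open ≡-Reasoning
    o = suc (2 * i)
    F = inversions (suc n) W
    b≡′ : b ≡ suc o
    b≡′ = trans b≡ (*-suc 2 i)
    ¬b<ᵇ : ∀ {j} → j ≤ suc o → ¬ T (b <ᵇ j)
    ¬b<ᵇ {j} j≤ t = <⇒≱ (<ᵇ⇒< b j t) (subst (j ≤_) (sym b≡′) j≤)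
    F≡0 : ∀ {j} → a ≡ j ⊎ b ≡ j → F j ≡ 0
    F≡0 (inj₁ refl) = trans (inversions-extend-new a∉ (inj₁ refl))
                            (if-false (¬b<ᵇ (subst (_≤ suc o) (sym a≡) (n≤1+n o))))
    F≡0 (inj₂ refl) = trans (inversions-extend-new b∉ (inj₂ refl)) (if-false (¬b<ᵇ (≤-reflexive b≡′)))
    old-block : ∀ {j} → j ∈ upTo o → F j ≡ inversions n w j
    old-block j∈ = trans (inversions-extend-old (occupied (∈-upTo⁻ j∈)))
                         (trans (cong₂ _+_ refl (if-false (¬b<ᵇ (<⇒≤ (<-trans (∈-upTo⁻ j∈) (n<1+n o))))))
                                (+-identityʳ _))
    old : ∑ (upTo o) F ≡ inv n i w
    old = trans (ℕΣ.∑-cong (upTo o) old-block) (sym (inv≡∑inversions n i w))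

  symmetric-restrict : ∀ {k} → Standard (suc n) k W →
                       ∀ {x} → x ∈ elems n → lab n w (- x) ≡ partner (lab n w x)
  symmetric-restrict S x∈ = trans (sym (lab-extend-inner (neg-∈-elems {n} x∈)))
                                  (trans (Standard.symmetric S (∈-elems-suc⁺ (inj₂ (inj₁ x∈))))
                                         (cong partner (lab-extend-inner x∈)))

  extend-partner : ∀ {k} → Standard (suc n) k W → a ≡ partner b
  extend-partner S = trans (sym lab-extend-neg)
                           (trans (Standard.symmetric S (∈-elems-suc⁺ (inj₂ (inj₂ refl))))
                                  (cong partner lab-extend-pos))

  partner-∉ : ∀ {k} → Standard (suc n) k W → b ∉ w → a ∉ w
  partner-∉ S b∉ a∈ = b∉ (subst (_∈ w) (trans (cong partner (extend-partner S)) (partner-involutive b))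
                                       (partner-∈ |w| (symmetric-restrict S) a∈))

  standard-extend : ∀ {k} → Standard n k w → a ≡ partner b → Standard (suc n) k W
  standard-extend {k} S a≡ = record
    { zero∈S₀       = trans (lab-extend-inner (+-∈-elems {n = n} z≤n)) zero∈S₀
    ; occupied      = ∈-extend⁺ ∘ occupied
    ; symmetric     = symmetric′
    ; min∈S         = λ i< → trans (lab-mval-extend (occupied (even-index< i<))) (min∈S i<)
    ; mins-increase = λ {i} si< →
        subst₂ _<_ (sym (mval-extend-old (occupied (even-index< (<-trans (n<1+n i) si<)))))
                   (sym (mval-extend-old (occupied (even-index< si<))))
                   (mins-increase si<)
    }
    where
    open Standard S
    symmetric′ : ∀ {x} → x ∈ elems (suc n) → lab (suc n) W (- x) ≡ partner (lab (suc n) W x)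
    symmetric′ x∈ with ∈-elems-suc⁻ {n} x∈
    ... | inj₁ refl        = trans lab-extend-pos
                                   (sym (trans (cong partner (trans lab-extend-neg a≡)) (partner-involutive b)))
    ... | inj₂ (inj₁ x∈n)  = trans (lab-extend-inner (neg-∈-elems {n} x∈n))
                                   (trans (symmetric x∈n) (cong partner (sym (lab-extend-inner x∈n))))
    ... | inj₂ (inj₂ refl) = trans lab-extend-neg (trans a≡ (cong partner (sym lab-extend-pos)))

  standard-restrict : ∀ {k k′} → Standard (suc n) k W → k′ ≤ k →
                      (∀ {j} → j < suc (2 * k′) → j ∈ w) → Standard n k′ w
  standard-restrict S k′≤k occupied′ = record
    { zero∈S₀       = trans (sym (lab-extend-inner (+-∈-elems {n = n} z≤n))) zero∈S₀
    ; occupied      = occupied′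
    ; symmetric     = symmetric-restrict S
    ; min∈S         = λ i< → trans (sym (lab-mval-extend (occupied′ (even-index< i<))))
                                   (min∈S (<-≤-trans i< k′≤k))
    ; mins-increase = λ {i} si< →
        subst₂ _<_ (mval-extend-old (occupied′ (even-index< (<-trans (n<1+n i) si<))))
                   (mval-extend-old (occupied′ (even-index< si<)))
                   (mins-increase (<-≤-trans si< k′≤k))
    }
    where open Standard S

  standard-restrict-old : ∀ {k} → Standard (suc n) k W → b ∈ w → Standard n k w
  standard-restrict-old {k} S b∈ = standard-restrict S ≤-refl occupied′
    where
    a∈ : a ∈ w
    a∈ = subst (_∈ w) (sym (extend-partner S)) (partner-∈ |w| (symmetric-restrict S) b∈)
    occupied′ : ∀ {j} → j < suc (2 * k) → j ∈ w
    occupied′ j< with ∈-extend⁻ (Standard.occupied S j<)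
    ... | inj₁ refl        = a∈
    ... | inj₂ (inj₁ j∈)   = j∈
    ... | inj₂ (inj₂ refl) = b∈

  -- b ≠ 0 since 0 ∈ w.  If b were odd, a would be even with S_a = {-(n+1)}, so m_a = n+1 ∉ S_a.
  -- If b = 2i+2 < 2k, then m_{2i+2} = n+1 could not be smaller than m_{2i+4}.
  fresh-pair : ∀ {k} → Standard (suc n) k W → b < suc (2 * k) → b ∉ w →
               ∃[ i ] k ≡ suc i × b ≡ 2 * suc i
  fresh-pair {k} S b< b∉ = go (partnerView b) refl
    where
    open Standard S
    go : ∀ {j} → PartnerView j → j ≡ b → ∃[ i ] k ≡ suc i × b ≡ 2 * suc i
    go isZero e = contradiction (subst (_∈ w) (trans (trans (sym (lab-extend-inner +0∈)) zero∈S₀) e)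
                                       (∈-labels⁺ |w| +0∈))
                                b∉
      where
      +0∈ : + 0 ∈ elems n
      +0∈ = +-∈-elems {n = n} z≤n
    go (isOdd i) e = contradiction (trans e (trans (sym lab-extend-pos) (trans lab-fresh (*-suc 2 i))))
                                   (1+n≢n ∘ sym)
      where
      a≡ : a ≡ 2 * suc i
      a≡ = trans (extend-partner S) (trans (cong partner (sym e)) (partner-odd i))
      i<k : i < k
      i<k = even-index<⁻ (subst (_< suc (2 * k)) a≡ (subst (_< suc (2 * k)) (sym (extend-partner S))
                                                           (partner-< {k = k} b<)))
      lab-fresh : lab (suc n) W (+ suc n) ≡ 2 * suc i
      lab-fresh = trans (cong (λ m → lab (suc n) W (+ m))
                              (sym (mval-extend-new (subst (_∉ w) a≡ (partner-∉ S b∉)) (inj₁ a≡))))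
                        (min∈S i<k)
    go (isEven i) e = i , ≤-antisym (≮⇒≥ last) (even-index<⁻ (subst (_< suc (2 * k)) (sym e) b<)) , sym e
      where
      mval-b : mval (suc n) W (2 * suc i) ≡ suc n
      mval-b = mval-extend-new (subst (_∉ w) (sym e) b∉) (inj₂ (sym e))
      last : ¬ suc i < k
      last si< = <⇒≱ (subst (_< mval (suc n) W (2 * suc (suc i))) mval-b (mins-increase si<))
                     (mval-≤ (suc n) W _)

  standard-grow : ∀ {i} → Standard n i w → All (_< suc (2 * i)) w → a ≡ suc (2 * i) → b ≡ 2 * suc i →
                  Standard (suc n) (suc i) W
  standard-grow {i} S letters a≡ b≡ = record
    { zero∈S₀       = zero∈S₀
    ; occupied      = occupied′
    ; symmetric     = symmetric
    ; min∈S         = min∈S′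
    ; mins-increase = mins-increase′
    }
    where
    S⁺ : Standard (suc n) i W
    S⁺ = standard-extend S (trans a≡ (trans (sym (partner-even i)) (cong partner (sym b≡))))
    open Standard S⁺
    b∉ : b ∉ w
    b∉ b∈ = <-asym (All.lookup letters b∈) (subst (suc (2 * i) <_) (sym b≡) (odd<even i))
    mval-b : mval (suc n) W (2 * suc i) ≡ suc n
    mval-b = mval-extend-new (subst (_∉ w) b≡ b∉) (inj₂ b≡)
    occupied′ : ∀ {j} → j < suc (2 * suc i) → j ∈ W
    occupied′ {j} j< with m≤n⇒m<n∨m≡n (s≤s⁻¹ (subst (j <_) (cong suc (*-suc 2 i)) j<))
    ... | inj₂ refl = there (∈-++⁺ʳ w (here (trans (sym (*-suc 2 i)) (sym b≡))))
    ... | inj₁ j<   with m≤n⇒m<n∨m≡n (s≤s⁻¹ j<)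
    ...   | inj₁ j<odd = occupied j<odd
    ...   | inj₂ refl  = here (sym a≡)
    min∈S′ : ∀ {i′} → i′ < suc i → lab (suc n) W (+ mval (suc n) W (2 * suc i′)) ≡ 2 * suc i′
    min∈S′ i′< with m≤n⇒m<n∨m≡n (s≤s⁻¹ i′<)
    ... | inj₁ i′<i = min∈S i′<i
    ... | inj₂ refl = trans (cong (λ m → lab (suc n) W (+ m)) mval-b) (trans lab-extend-pos b≡)
    mins-increase′ : ∀ {i′} → suc i′ < suc i →
                     mval (suc n) W (2 * suc i′) < mval (suc n) W (2 * suc (suc i′))
    mins-increase′ {i′} si′< with m≤n⇒m<n∨m≡n (s≤s⁻¹ si′<)
    ... | inj₁ si′<i = mins-increase si′<i
    ... | inj₂ refl  = subst₂ _<_ (sym (mval-extend-old (Standard.occupied S (even-index< (n<1+n i′)))))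
                              (sym mval-b)
                              (s≤s (mval-≤ n w _))

  standard-fresh⇔ : ∀ {i} → a ≡ suc (2 * i) → b ≡ 2 * suc i → All (_< suc (2 * i)) w →
                    Standard (suc n) (suc i) W ⇔ Standard n i w
  standard-fresh⇔ {i} a≡ b≡ letters = mk⇔ (λ S → standard-restrict S (n≤1+n i) (occupied′ S))
                                          (λ S → standard-grow S letters a≡ b≡)
    where
    occupied′ : Standard (suc n) (suc i) W → ∀ {j} → j < suc (2 * i) → j ∈ w
    occupied′ S {j} j< with ∈-extend⁻ (Standard.occupied S (<-≤-trans j< (s≤s (*-monoʳ-≤ 2 (n≤1+n i)))))
    ... | inj₁ refl        = contradiction a≡ (<⇒≢ j<)
    ... | inj₂ (inj₁ j∈)   = j∈
    ... | inj₂ (inj₂ refl) = ⊥-elim (<-asym j< (subst (suc (2 * i) <_) (sym b≡) (odd<even i)))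

-- The weighted recurrence

module Weights {c ℓ} (R : CommutativeSemiring c ℓ) (q : CommutativeSemiring.Carrier R) where

  private module R = CommutativeSemiring R
  open R using (Carrier; _≈_; 0#; 1#) renaming (_+_ to _⊕_; _*_ to _⊛_)
  open Sums R
  open SetoidReasoning R.setoid

  q^_ : ℕ → Carrier
  q^_ = pow R q

  [_] : ℕ → Carrier
  [_] = qint R q

  q^-+ : ∀ m n → q^ (m + n) ≈ q^ m ⊛ q^ n
  q^-+ zero    n = R.sym (R.*-identityˡ _)
  q^-+ (suc m) n = R.trans (R.*-cong R.refl (q^-+ m n)) (R.sym (R.*-assoc q _ _))

  ∑-q^ : ∀ m → ∑[ b ← upTo m ] q^ (m ∸ suc b) ≈ [ m ]
  ∑-q^ zero    = R.refl
  ∑-q^ (suc m) = begin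
    q^ m ⊕ ∑[ b ← applyUpTo suc m ] q^ (m ∸ b)
      ≡⟨ ≡.cong (λ xs → q^ m ⊕ ∑[ b ← xs ] q^ (m ∸ b)) (≡.sym (List.map-upTo suc m)) ⟩
    q^ m ⊕ ∑[ b ← map suc (upTo m) ] q^ (m ∸ b)
      ≡⟨ ≡.cong (q^ m ⊕_) (∑-map suc (upTo m) _) ⟩
    q^ m ⊕ ∑[ b ← upTo m ] q^ (m ∸ suc b)
      ≈⟨ R.+-cong R.refl (∑-q^ m) ⟩
    q^ m ⊕ [ m ]
      ≈⟨ shift m ⟩
    1# ⊕ q ⊛ [ m ]
      ∎
    where
    shift : ∀ m → q^ m ⊕ [ m ] ≈ 1# ⊕ q ⊛ [ m ]
    shift zero    = R.+-cong R.refl (R.sym (R.zeroʳ q))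
    shift (suc m) = begin
      q ⊛ q^ m ⊕ (1# ⊕ q ⊛ [ m ])   ≈⟨ R.sym (R.+-assoc _ _ _) ⟩
      (q ⊛ q^ m ⊕ 1#) ⊕ q ⊛ [ m ]   ≈⟨ R.+-cong (R.+-comm _ _) R.refl ⟩
      (1# ⊕ q ⊛ q^ m) ⊕ q ⊛ [ m ]   ≈⟨ R.+-assoc _ _ _ ⟩
      1# ⊕ (q ⊛ q^ m ⊕ q ⊛ [ m ])   ≈⟨ R.+-cong R.refl (R.sym (R.distribˡ q _ _)) ⟩
      1# ⊕ q ⊛ (q^ m ⊕ [ m ])       ≈⟨ R.+-cong R.refl (R.*-cong R.refl (shift m)) ⟩
      1# ⊕ q ⊛ (1# ⊕ q ⊛ [ m ])     ∎

  ∑-partner : ∀ k g →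
              ∑[ b ← upTo (suc (2 * k)) ] ∑[ a ← upTo (suc (2 * k)) ] (if a ≡ᵇ partner b then g b else 0#)
              ≈ ∑ (upTo (suc (2 * k))) g
  ∑-partner k g =
    ∑-cong (upTo (suc (2 * k))) (λ {b} b∈ → ∑-upTo-indicator (g b) (partner-< {k = k} (∈-upTo⁻ b∈)))

  weight : ℕ → ℕ → List ℕ → Carrier
  weight n k w = if isStd n k w then q^ inv n k w else 0#

  -- The weight of extend (2k-1) w (2k) if there {-(n+1)} and {n+1} are blocks of their own, else 0.
  freshWeight : ℕ → ℕ → List ℕ → Carrier
  freshWeight n zero    w = 0#
  freshWeight n (suc i) w = if allB (_<ᵇ suc (2 * i)) w then weight n i w else 0#

  SBsum≈∑weight : ∀ n k → SBsum R q n k ≈ ∑ (words (suc (2 * n)) (suc (2 * k))) (weight n k)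
  SBsum≈∑weight n k = ∑-filter (isStd n k) (words (suc (2 * n)) (suc (2 * k))) (λ w → q^ inv n k w)

  module _ {n : ℕ} {w : List ℕ} (|w| : length w ≡ suc (2 * n)) where

    private
      standardʷ⁻ : ∀ {k} → T (isStd n k w) → Standard n k w
      standardʷ⁻ = standard⁻ |w|

      standardʷ⁺ : ∀ {k} → Standard n k w → T (isStd n k w)
      standardʷ⁺ = standard⁺ |w|

    module _ (a b : ℕ) where

      open Extension {n} {w} a b |w|

      private
        W : List ℕ
        W = extend a w b

        standardᵂ⁻ : ∀ {k} → T (isStd (suc n) k W) → Standard (suc n) k W
        standardᵂ⁻ = standard⁻ length-extend

        standardᵂ⁺ : ∀ {k} → Standard (suc n) k W → T (isStd (suc n) k W)
        standardᵂ⁺ = standard⁺ length-extend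

      weight-extend-standard : ∀ {k} → T (isStd n k w) →
        weight (suc n) k W ≡ (if a ≡ᵇ partner b then q^ (inv n k w + (2 * k ∸ b)) else 0#)
      weight-extend-standard {k} t =
        if-cong (mk⇔ (≡⇒≡ᵇ a (partner b) ∘ extend-partner ∘ standardᵂ⁻ {k})
                     (standardᵂ⁺ ∘ standard-extend S ∘ ≡ᵇ⇒≡ a (partner b)))
                (λ _ → ≡.cong q^_ (inv-extend-old {k} (Standard.occupied S)))
        where
        S : Standard n k w
        S = standardʷ⁻ t

      weight-extend-fresh-suc : ∀ {i} → ¬ T (isStd n (suc i) w) → All (_< suc (2 * suc i)) w →
                            a ≡ suc (2 * i) → b ≡ 2 * suc i →
                            weight (suc n) (suc i) W ≡ freshWeight n (suc i) w
      weight-extend-fresh-suc {i} ¬S letters a≡ b≡ with allB (_<ᵇ suc (2 * i)) w in e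
      ... | true  =
        if-cong (mk⇔ (standardʷ⁺ ∘ to fresh⇔ ∘ standardᵂ⁻)
                     (standardᵂ⁺ ∘ from fresh⇔ ∘ standardʷ⁻ {i}))
                (λ t → ≡.cong q^_ (inv-extend-new a≡ b≡ (a∉ letters′) (b∉ letters′)
                                                   (Standard.occupied (to fresh⇔ (standardᵂ⁻ t)))))
        where
        letters′ : All (_< suc (2 * i)) w
        letters′ = All.tabulate (λ j∈ → <ᵇ⇒< _ _ (allB⁻ (_<ᵇ suc (2 * i)) (subst T (sym e) tt) j∈))
        a∉ : All (_< suc (2 * i)) w → a ∉ w
        a∉ ls a∈ = <-irrefl a≡ (All.lookup ls a∈)
        b∉ : All (_< suc (2 * i)) w → b ∉ w
        b∉ ls b∈ = <-asym (All.lookup ls b∈) (subst (suc (2 * i) <_) (sym b≡) (odd<even i))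
        fresh⇔ : Standard (suc n) (suc i) W ⇔ Standard n i w
        fresh⇔ = standard-fresh⇔ a≡ b≡ letters′
      ... | false =
        if-false λ t → subst T e (allB⁺ (_<ᵇ suc (2 * i)) w (λ j∈ → <⇒<ᵇ (All.lookup (shrunk t) j∈)))
        where
        shrunk : T (isStd (suc n) (suc i) W) → All (_< suc (2 * i)) w
        shrunk t = letters-shrink letters (subst (_∉ w) a≡ (partner-∉ S b∉)) (subst (_∉ w) b≡ b∉)
          where
          S = standardᵂ⁻ t
          b∉ : b ∉ w
          b∉ b∈ = ¬S (standardʷ⁺ (standard-restrict-old {suc i} S b∈))

      weight-extend-fresh : ∀ {k} → ¬ T (isStd n k w) → All (_< suc (2 * k)) w →
                           a ≡ partner b → b ≡ 2 * k → weight (suc n) k W ≡ freshWeight n k w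
      weight-extend-fresh {zero}  ¬S _       _  b≡ = if-false (λ t → case pair t of λ { (i , () , _) })
        where
        pair : T (isStd (suc n) 0 W) → ∃[ i ] 0 ≡ suc i × b ≡ 2 * suc i
        pair t = let S = standardᵂ⁻ t in
                 fresh-pair S (s≤s (≤-reflexive b≡)) (λ b∈ → ¬S (standardʷ⁺ (standard-restrict-old {0} S b∈)))
      weight-extend-fresh {suc i} ¬S letters a≡ b≡ =
        weight-extend-fresh-suc ¬S letters (trans a≡ (trans (cong partner b≡) (partner-even i))) b≡

      weight-extend-nonstandard : ∀ {k} → ¬ T (isStd n k w) → All (_< suc (2 * k)) w → b < suc (2 * k) →
        weight (suc n) k W ≡ (if a ≡ᵇ partner b then (if b ≡ᵇ 2 * k then freshWeight n k w else 0#) else 0#)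
      weight-extend-nonstandard {k} ¬S letters b< with T? (a ≡ᵇ partner b) | T? (b ≡ᵇ 2 * k)
      ... | no ¬a≡ | _      =
        trans (if-false (¬a≡ ∘ ≡⇒≡ᵇ a (partner b) ∘ extend-partner ∘ standardᵂ⁻ {k}))
              (sym (if-false ¬a≡))
      ... | yes a≡ | no ¬b≡ =
        trans (if-false (¬b≡ ∘ ≡⇒≡ᵇ b (2 * k) ∘ b≡2k)) (sym (trans (if-true a≡) (if-false ¬b≡)))
        where
        b≡2k : T (isStd (suc n) k W) → b ≡ 2 * k
        b≡2k t = let S = standardᵂ⁻ t
                     i , k≡ , b≡ = fresh-pair S b< (λ b∈ → ¬S (standardʷ⁺ (standard-restrict-old {k} S b∈)))
                 in trans b≡ (cong (2 *_) (sym k≡))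
      ... | yes a≡ | yes b≡ =
        trans (weight-extend-fresh {k} ¬S letters (≡ᵇ⇒≡ a (partner b) a≡) (≡ᵇ⇒≡ b (2 * k) b≡))
              (sym (trans (if-true a≡) (if-true b≡)))

    freshWeight-standard : ∀ {k} → T (isStd n k w) → freshWeight n k w ≡ 0#
    freshWeight-standard {zero}  _ = refl
    freshWeight-standard {suc i} t =
      if-false (λ ls → standard⇒¬letters-shrink (standardʷ⁻ {suc i} t)
                                                (All.tabulate (<ᵇ⇒< _ _ ∘ allB⁻ (_<ᵇ suc (2 * i)) ls)))

    ∑-extend : ∀ {k} → All (_< suc (2 * k)) w →
               ∑[ b ← upTo (suc (2 * k)) ] ∑[ a ← upTo (suc (2 * k)) ] weight (suc n) k (extend a w b)
               ≈ [ suc (2 * k) ] ⊛ weight n k w ⊕ freshWeight n k w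
    ∑-extend {k} letters with T? (isStd n k w)
    ... | yes t = begin
      ∑[ b ← U ] ∑[ a ← U ] weight (suc n) k (extend a w b)
        ≈⟨ ∑-cong U (λ {b} _ → ∑-cong U (λ {a} _ → R.reflexive (weight-extend-standard a b {k} t))) ⟩
      ∑[ b ← U ] ∑[ a ← U ] (if a ≡ᵇ partner b then q^ (inv n k w + (2 * k ∸ b)) else 0#)
        ≈⟨ ∑-partner k _ ⟩
      ∑[ b ← U ] q^ (inv n k w + (2 * k ∸ b))
        ≈⟨ ∑-cong U (λ {b} _ → q^-+ (inv n k w) (2 * k ∸ b)) ⟩
      ∑[ b ← U ] (q^ inv n k w ⊛ q^ (2 * k ∸ b))
        ≈⟨ ∑-*ˡ U (q^ inv n k w) _ ⟩
      q^ inv n k w ⊛ ∑[ b ← U ] q^ (2 * k ∸ b)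
        ≈⟨ R.*-cong R.refl (∑-q^ (suc (2 * k))) ⟩
      q^ inv n k w ⊛ [ suc (2 * k) ]
        ≈⟨ R.*-comm _ _ ⟩
      [ suc (2 * k) ] ⊛ q^ inv n k w
        ≈⟨ R.sym (R.+-identityʳ _) ⟩
      [ suc (2 * k) ] ⊛ q^ inv n k w ⊕ 0#
        ≈⟨ R.+-cong (R.*-cong R.refl (R.reflexive (sym (if-true t))))
                    (R.reflexive (sym (freshWeight-standard {k} t))) ⟩
      [ suc (2 * k) ] ⊛ weight n k w ⊕ freshWeight n k w
        ∎
      where U = upTo (suc (2 * k))
    ... | no ¬t = begin
      ∑[ b ← U ] ∑[ a ← U ] weight (suc n) k (extend a w b)
        ≈⟨ ∑-cong U (λ {b} b∈ → ∑-cong U (λ {a} _ →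
             R.reflexive (weight-extend-nonstandard a b {k} ¬t letters (∈-upTo⁻ b∈)))) ⟩
      ∑[ b ← U ] ∑[ a ← U ] (if a ≡ᵇ partner b then g b else 0#)
        ≈⟨ ∑-partner k _ ⟩
      ∑[ b ← U ] g b
        ≈⟨ ∑-upTo-indicator _ (n<1+n (2 * k)) ⟩
      freshWeight n k w
        ≈⟨ R.sym (R.+-identityˡ _) ⟩
      0# ⊕ freshWeight n k w
        ≈⟨ R.+-cong (R.sym (R.zeroʳ _)) R.refl ⟩
      [ suc (2 * k) ] ⊛ 0# ⊕ freshWeight n k w
        ≈⟨ R.+-cong (R.*-cong R.refl (R.reflexive (sym (if-false ¬t)))) R.refl ⟩
      [ suc (2 * k) ] ⊛ weight n k w ⊕ freshWeight n k w
        ∎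
      where
      U = upTo (suc (2 * k))
      g : ℕ → Carrier
      g b = if b ≡ᵇ 2 * k then freshWeight n k w else 0#

  SBsum-suc : ∀ n k → SBsum R q (suc n) k ≈
              [ suc (2 * k) ] ⊛ SBsum R q n k ⊕ ∑ (words (suc (2 * n)) (suc (2 * k))) (freshWeight n k)
  SBsum-suc n k = begin
    SBsum R q (suc n) k
      ≈⟨ SBsum≈∑weight (suc n) k ⟩
    ∑ (words (suc (2 * suc n)) K) (weight (suc n) k)
      ≡⟨ ≡.cong (λ m → ∑ (words (suc m) K) (weight (suc n) k)) (*-suc 2 n) ⟩
    ∑ (words (suc (suc L)) K) (weight (suc n) k)
      ≈⟨ ∑-words-suc (suc L) K _ ⟩
    ∑[ v ← words (suc L) K ] ∑[ a ← upTo K ] weight (suc n) k (a ∷ v)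
      ≈⟨ ∑-words-snoc L K _ ⟩
    ∑[ w ← words L K ] ∑[ b ← upTo K ] ∑[ a ← upTo K ] weight (suc n) k (extend a w b)
      ≈⟨ ∑-cong (words L K) (λ w∈ → let |w| , letters = ∈-words⁻ {L} w∈ in
                                       ∑-extend |w| {k} letters) ⟩
    ∑[ w ← words L K ] ([ K ] ⊛ weight n k w ⊕ freshWeight n k w)
      ≈⟨ ∑-+ (words L K) _ _ ⟩
    ∑[ w ← words L K ] ([ K ] ⊛ weight n k w) ⊕ ∑ (words L K) (freshWeight n k)
      ≈⟨ R.+-cong (∑-*ˡ (words L K) [ K ] _) R.refl ⟩
    [ K ] ⊛ ∑ (words L K) (weight n k) ⊕ ∑ (words L K) (freshWeight n k)
      ≈⟨ R.+-cong (R.*-cong R.refl (R.sym (SBsum≈∑weight n k))) R.refl ⟩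
    [ K ] ⊛ SBsum R q n k ⊕ ∑ (words L K) (freshWeight n k)
      ∎
    where
    L = suc (2 * n)
    K = suc (2 * k)

  SBsum-zero-suc : ∀ k → SBsum R q 0 (suc k) ≈ 0#
  SBsum-zero-suc k = R.trans (SBsum≈∑weight 0 (suc k))
                             (R.trans (∑-cong (words 1 K) (λ w∈ → R.reflexive (if-false (¬standard w∈))))
                                      (∑-zero (words 1 K)))
    where
    K = suc (2 * suc k)
    ¬standard : ∀ {w} → w ∈ words 1 K → ¬ T (isStd 0 (suc k) w)
    ¬standard {w} w∈ t = let |w| = proj₁ (∈-words⁻ w∈) in
                         ¬standard-0-suc |w| (standard⁻ {0} {suc k} {w} |w| t)

  SBsum-suc-zero : ∀ n → SBsum R q (suc n) 0 ≈ [ 1 ] ⊛ SBsum R q n 0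
  SBsum-suc-zero n = R.trans (SBsum-suc n 0) (R.trans (R.+-cong R.refl (∑-zero (words (suc (2 * n)) 1)))
                                                      (R.+-identityʳ _))

  SBsum-suc-suc : ∀ n k →
                  SBsum R q (suc n) (suc k) ≈ SBsum R q n k ⊕ [ 2 * suc k + 1 ] ⊛ SBsum R q n (suc k)
  SBsum-suc-suc n k = begin
    SBsum R q (suc n) (suc k)
      ≈⟨ SBsum-suc n (suc k) ⟩
    [ K ] ⊛ SBsum R q n (suc k) ⊕ ∑ (words (suc (2 * n)) K) (freshWeight n (suc k))
      ≈⟨ R.+-cong R.refl fresh ⟩
    [ K ] ⊛ SBsum R q n (suc k) ⊕ SBsum R q n k
      ≈⟨ R.+-comm _ _ ⟩
    SBsum R q n k ⊕ [ K ] ⊛ SBsum R q n (suc k)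
      ≡⟨ ≡.cong (λ m → SBsum R q n k ⊕ [ m ] ⊛ SBsum R q n (suc k)) (+-comm 1 (2 * suc k)) ⟩
    SBsum R q n k ⊕ [ 2 * suc k + 1 ] ⊛ SBsum R q n (suc k)
      ∎
    where
    K = suc (2 * suc k)
    fresh : ∑ (words (suc (2 * n)) K) (freshWeight n (suc k)) ≈ SBsum R q n k
    fresh = R.sym (R.trans (SBsum≈∑weight n k)
                           (∑-words-≤ (suc (2 * n)) (weight n k) (s≤s (*-monoʳ-≤ 2 (n≤1+n k)))))

theorem3p7 : ∀ {c ℓ} (R : CommutativeSemiring c ℓ) (q : CommutativeSemiring.Carrier R) (n k : ℕ) →
    CommutativeSemiring._≈_ R (SB R q n k) (SBsum R q n k)
theorem3p7 R q n k = SB≈SBsum n k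
  where
  module R = CommutativeSemiring R
  open R using (_≈_; 1#)
  open Weights R q
  SB≈SBsum : ∀ n k → SB R q n k ≈ SBsum R q n k
  -- SBsum R q 0 0 evaluates to 1# ⊕ 0#, the only word [0] being standard without inversions.
  SB≈SBsum zero    zero    = R.sym (R.+-identityʳ 1#)
  SB≈SBsum zero    (suc k) = R.sym (SBsum-zero-suc k)
  SB≈SBsum (suc n) zero    = R.trans (R.*-cong R.refl (SB≈SBsum n 0)) (R.sym (SBsum-suc-zero n))
  SB≈SBsum (suc n) (suc k) = R.trans (R.+-cong (SB≈SBsum n k) (R.*-cong R.refl (SB≈SBsum n (suc k))))
                                     (R.sym (SBsum-suc-suc n k))
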